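{- Let $t\ge3$ be an odd integer. For every rational $d>t-1$ there exist positive integers $a,b$ with $a$ even and $2a+2\le b$ such that \[\frac{3t-9}{4}+\frac{t-3}{2a}+\frac{b}{a}=d.\] -}

module Defs where

open import Data.Nat using (ℕ; _<_; _*_; _∸_; NonZero; >-nonZero)
open import Data.Nat.Properties using (*-monoʳ-<)
open import Data.Integer using (+_)
open import Data.Rational using (ℚ; _/_; _+_)

-- The quantity (3t-9)/4 + (t-3)/(2a) + b/a, for a positive integer a
-- (positivity witness needed for division). Natural subtraction ∸ is
-- exact here since t ≥ 3 in the statement.
expr : (t a b : ℕ) → 0 < a → ℚ
expr t a b a>0 =
  (+ (3 * t ∸ 9)) / 4
  + _/_ (+ (t ∸ 3)) (2 * a) {{>-nonZero (*-monoʳ-< 2 a>0)}}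
  + _/_ (+ b) a {{>-nonZero a>0}}

module Submission where

-- Write t = 3 + 2r and d = P/q in lowest terms, so that d > t − 1 means
-- P = (t − 1)q + 1 + e for some e ≥ 0. Take a = 2q and b = 2a + 2 + r(q − 1) + 2e.
-- Then (3t − 9)/4 + (t − 3)/(2a) + b/a = 3r/2 + (r + b)/(2q) = 2r + 2 + (1 + e)/q = P/q,
-- and 2a + 2 ≤ b holds by construction.

open import Defs
open import Data.Nat using (ℕ; _≤_; _<_; _*_; _+_; _∸_)
open import Data.Nat.Divisibility using (_∣_)
open import Data.Integer using (+_)
open import Data.Rational using (ℚ; _/_) renaming (_<_ to _<ℚ_)
open import Data.Product using (Σ; _×_)
open import Relation.Nullary using (¬_)
open import Relation.Binary.PropositionalEquality using (_≡_)

open import Data.Nat using (suc; s≤s; z<s; NonZero; >-nonZero)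
open import Data.Nat.Properties using (*-suc; *-monoʳ-<; *-distribˡ-∸; m≤m+n; m+[n∸m]≡n)
open import Data.Nat.Divisibility using (divides; ∣m∣n⇒∣m+n; ∣-refl; m∣m*n)
open import Data.Nat.Tactic.RingSolver using (solve-∀)
import Data.Integer as ℤ
open import Data.Integer.Properties using (pos-*; *-identityʳ)
open import Data.Rational using (mkℚ; ↥_; ↧ₙ_; toℚᵘ) renaming (_+_ to _+ℚ_)
open import Data.Rational.Properties using (toℚᵘ-fromℚᵘ; toℚᵘ-injective; toℚᵘ-homo-+; toℚᵘ-mono-<; ↥p/↧p≡p)
open import Data.Rational.Unnormalised as ℚᵘ using (mkℚᵘ; _≃_; *≡*)
open import Data.Rational.Unnormalised.Properties using (≃-refl; ≃-sym; +-cong; <-respˡ-≃; drop-*<*; module ≃-Reasoning)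
open import Data.Product using (∃-syntax; _,_)
open import Function using (_∘_)
open import Relation.Nullary using (contradiction)
open import Relation.Binary.PropositionalEquality using (refl; sym; trans; cong; subst)

odd⇒≡1+2* : ∀ {n} → ¬ 2 ∣ n → ∃[ k ] n ≡ 1 + 2 * k
odd⇒≡1+2* {0} 2∤n = contradiction (divides 0 refl) 2∤n
odd⇒≡1+2* {1} 2∤n = 0 , refl
odd⇒≡1+2* {suc (suc n)} 2∤n with k , refl ← odd⇒≡1+2* (2∤n ∘ ∣m∣n⇒∣m+n ∣-refl) =
  suc k , cong suc (sym (*-suc 2 k))

odd≥3⇒≡3+2* : ∀ {t} → 3 ≤ t → ¬ 2 ∣ t → ∃[ r ] t ≡ 3 + 2 * r
odd≥3⇒≡3+2* 3≤t 2∤t with odd⇒≡1+2* 2∤t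
... | 0     , refl = contradiction 3≤t λ { (s≤s ()) }
... | suc r , refl = r , cong suc (*-suc 2 r)

toℚᵘ-/ : ∀ i n .{{_ : NonZero n}} → toℚᵘ (i / n) ≃ i ℚᵘ./ n
toℚᵘ-/ i (suc n) = toℚᵘ-fromℚᵘ (mkℚᵘ i n)

n/1<p⇒n*↧p<↥p : ∀ n p → + n / 1 <ℚ p → + (n * ↧ₙ p) ℤ.< ↥ p
n/1<p⇒n*↧p<↥p n p@record{} n<p
  with cross ← drop-*<* (<-respˡ-≃ (toℚᵘ-/ (+ n) 1) (toℚᵘ-mono-< n<p))
  rewrite *-identityʳ (↥ p) | sym (pos-* n (↧ₙ p)) = cross

pos-homo-cross₃ : ∀ x y z m n o D → ((+ x ℤ.* + n ℤ.+ + y ℤ.* + m) ℤ.* + o ℤ.+ + z ℤ.* + (m * n)) ℤ.* + D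
             ≡ + (((x * n + y * m) * o + z * (m * n)) * D)
pos-homo-cross₃ x y z m n o D
  rewrite sym (pos-* x n) | sym (pos-* y m) | sym (pos-* z (m * n))
        | sym (pos-* (x * n + y * m) o) | sym (pos-* ((x * n + y * m) * o + z * (m * n)) D) = refl

x/m+y/n+z/o≃N/D : ∀ x y z m n o N D .{{_ : NonZero m}} .{{_ : NonZero n}} .{{_ : NonZero o}} .{{_ : NonZero D}} →
        ((x * n + y * m) * o + z * (m * n)) * D ≡ N * (m * n * o) →
        (+ x ℚᵘ./ m) ℚᵘ.+ (+ y ℚᵘ./ n) ℚᵘ.+ (+ z ℚᵘ./ o) ≃ + N ℚᵘ./ D
x/m+y/n+z/o≃N/D x y z m@(suc _) n@(suc _) o@(suc _) N D@(suc _) eq =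
  *≡* (trans (pos-homo-cross₃ x y z m n o D) (trans (cong +_ eq) (pos-* N (m * n * o))))

x/m+y/n+z/o≡N/D : ∀ x y z m n o N D .{{_ : NonZero m}} .{{_ : NonZero n}} .{{_ : NonZero o}} .{{_ : NonZero D}} →
       ((x * n + y * m) * o + z * (m * n)) * D ≡ N * (m * n * o) →
       + x / m +ℚ + y / n +ℚ + z / o ≡ + N / D
x/m+y/n+z/o≡N/D x y z m n o N D eq = toℚᵘ-injective (begin
  toℚᵘ (+ x / m +ℚ + y / n +ℚ + z / o)
    ≈⟨ toℚᵘ-homo-+ (+ x / m +ℚ + y / n) (+ z / o) ⟩
  toℚᵘ (+ x / m +ℚ + y / n) ℚᵘ.+ toℚᵘ (+ z / o)
    ≈⟨ +-cong (toℚᵘ-homo-+ (+ x / m) (+ y / n)) ≃-refl ⟩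
  toℚᵘ (+ x / m) ℚᵘ.+ toℚᵘ (+ y / n) ℚᵘ.+ toℚᵘ (+ z / o)
    ≈⟨ +-cong (+-cong (toℚᵘ-/ (+ x) m) (toℚᵘ-/ (+ y) n)) (toℚᵘ-/ (+ z) o) ⟩
  (+ x ℚᵘ./ m) ℚᵘ.+ (+ y ℚᵘ./ n) ℚᵘ.+ (+ z ℚᵘ./ o)
    ≈⟨ x/m+y/n+z/o≃N/D x y z m n o N D eq ⟩
  + N ℚᵘ./ D
    ≈⟨ ≃-sym (toℚᵘ-/ (+ N) D) ⟩
  toℚᵘ (+ N / D) ∎)
  where open ≃-Reasoning

expr≡/ : ∀ t a b (a>0 : 0 < a) N D .{{_ : NonZero D}} →
         ((3 * (t ∸ 3) * (2 * a) + (t ∸ 3) * 4) * a + b * (4 * (2 * a))) * D ≡ N * (4 * (2 * a) * a) →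
         expr t a b a>0 ≡ + N / D
expr≡/ t a b a>0 N D eq rewrite sym (*-distribˡ-∸ 3 t 3) =
  x/m+y/n+z/o≡N/D (3 * (t ∸ 3)) (t ∸ 3) b 4 (2 * a) a N D {{_}} {{>-nonZero (*-monoʳ-< 2 a>0)}} {{>-nonZero a>0}} eq

Solution : ℕ → ℚ → Set
Solution t d = Σ ℕ λ a → Σ (0 < a) λ a>0 → Σ ℕ λ b → 0 < b × 2 ∣ a × 2 * a + 2 ≤ b × expr t a b a>0 ≡ d

-- The denominator q is written suc qq, as in mkℚ, so that r * qq is r(q − 1).
solution : ∀ r qq e → Solution (3 + 2 * r) (+ suc ((2 + 2 * r) * suc qq + e) / suc qq)
solution r qq e = a , z<s , b , z<s , m∣m*n q , m≤m+n _ _ , expr≡/ (3 + 2 * r) a b z<s _ q (identity r qq e)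
  where
  q = suc qq
  a = 2 * q
  b = 2 * a + 2 + (r * qq + 2 * e)
  identity : ∀ r qq e → let q = suc qq ; a = 2 * q ; b = 2 * a + 2 + (r * qq + 2 * e) in
             ((3 * (2 * r) * (2 * a) + 2 * r * 4) * a + b * (4 * (2 * a))) * q
             ≡ suc ((2 + 2 * r) * q + e) * (4 * (2 * a) * a)
  identity = solve-∀

proposition4p15 : (t : ℕ) → 3 ≤ t → ¬ (2 ∣ t) → (d : ℚ) → (+ (t ∸ 1)) / 1 <ℚ d →
    Σ ℕ λ a → Σ (0 < a) λ a>0 → Σ ℕ λ b → 0 < b × 2 ∣ a × 2 * a + 2 ≤ b × expr t a b a>0 ≡ d
proposition4p15 t 3≤t 2∤t d t-1<d with odd≥3⇒≡3+2* 3≤t 2∤t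
... | r , refl with d | n/1<p⇒n*↧p<↥p (2 + 2 * r) d t-1<d
...   | d@(mkℚ (+ P) qq _) | ℤ.+<+ [t-1]q<P =
  subst (Solution (3 + 2 * r)) (trans (cong (λ N → + N / suc qq) (m+[n∸m]≡n [t-1]q<P)) (↥p/↧p≡p d))
        (solution r qq _)
...   | mkℚ ℤ.-[1+ _ ] _ _ | ()
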